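{- Let $k\ge2$ and suppose $T=(A_1\otimes\cdots\otimes A_k)\mathsf{M}_n^k$ for linear maps $A_\ell$ with domain $\mathbb{C}^{n^2}$, with $\operatorname{rank}(A_k)=1$. Then $T=S\otimes w$ for some order-$(k-1)$ tensor $S$ with $\mathsf{M}_n^{k-1}\ge S$ and some vector $w$.
   Context: $\mathsf{M}_n^k=\sum_{i\in[n]^k}\bigotimes_{\ell=1}^k e_{i_\ell,i_{\ell+1}}\in(\mathbb{C}^{n^2})^{\otimes k}$ with $i_{k+1}=i_1$, where $e_{i,j}$ are standard basis vectors of $\mathbb{C}^{n^2}=\mathbb{C}^{n\times n}$. For order-$m$ tensors, $R\ge S$ means $S=(B_1\otimes\cdots\otimes B_m)R$ for some linear maps $B_1,\ldots,B_m$. -}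

module Defs where

open import Level using (Level; _⊔_)
open import Data.Nat using (ℕ; zero; suc)
import Data.Nat as Nat
open import Data.Fin using (Fin; zero; suc; combine; _≟_)
open import Data.Product using (Σ; ∃; _×_; _,_)
open import Relation.Nullary using (¬_; yes; no)
open import Algebra.Bundles using (CommutativeRing)
import Algebra.Properties.CommutativeMonoid.Sum as SumProps

-- A field: a commutative ring with 1 ≉ 0 in which every nonzero element
-- has a multiplicative inverse.  (Stands in for ℂ.)
record Field (c ℓ : Level) : Set (Level.suc (c ⊔ ℓ)) where
  field
    commutativeRing : CommutativeRing c ℓ
  open CommutativeRing commutativeRing public
  field
    1≉0     : ¬ (1# ≈ 0#)
    inverse : ∀ x → ¬ (x ≈ 0#) → ∃ λ y → (x * y) ≈ 1#

-- cyclic successor on Fin (suc k):  ℓ ↦ ℓ+1 mod (k+1)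
next : ∀ {k} → Fin (suc k) → Fin (suc k)
next {zero}  zero    = zero
next {suc k} zero    = suc zero
next {suc k} (suc i) with next {k} i
... | zero  = zero
... | suc j = suc (suc j)

module FieldDefs {c ℓ} (K : Field c ℓ) where
  open Field K hiding (zero)
  open SumProps +-commutativeMonoid using (sum)

  prod : ∀ {k} → (Fin k → Carrier) → Carrier
  prod {zero}  f = 1#
  prod {suc k} f = f zero * prod (λ i → f (suc i))

  Index : ∀ {k} → (Fin k → ℕ) → Set
  Index {k} d = (ℓ : Fin k) → Fin (d ℓ)

  Tensor : ∀ {k} → (Fin k → ℕ) → Set c
  Tensor d = Index d → Carrier

  consI : ∀ {k} {d : Fin (suc k) → ℕ} → Fin (d zero) → Index (λ ℓ → d (suc ℓ)) → Index d
  consI i j zero    = i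
  consI i j (suc ℓ) = j ℓ

  sumI : ∀ {k} (d : Fin k → ℕ) → (Index d → Carrier) → Carrier
  sumI {zero}  d f = f (λ ())
  sumI {suc k} d f = sum (λ i → sumI (λ ℓ → d (suc ℓ)) (λ j → f (consI {d = d} i j)))

  _≈T_ : ∀ {k} {d : Fin k → ℕ} → Tensor d → Tensor d → Set ℓ
  S ≈T T = ∀ j → S j ≈ T j

  -- m × n matrix = linear map K^n → K^m in the standard bases
  Matrix : ℕ → ℕ → Set c
  Matrix m n = Fin m → Fin n → Carrier

  applyT : ∀ {k} {d e : Fin k → ℕ} → ((ℓ : Fin k) → Matrix (e ℓ) (d ℓ)) → Tensor d → Tensor e
  applyT {d = d} A R j = sumI d (λ i → prod (λ ℓ → A ℓ (j ℓ) (i ℓ)) * R i)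

  _≥T_ : ∀ {k} {d e : Fin k → ℕ} → Tensor d → Tensor e → Set (c ⊔ ℓ)
  _≥T_ {k} {d} {e} R S = Σ ((ℓ : Fin k) → Matrix (e ℓ) (d ℓ)) λ B → S ≈T applyT B R

  -- rank: A has rank ≤ r iff it factors as A = B C with C : K^n → K^r
  RankLe : ∀ {m n} → Matrix m n → ℕ → Set (c ⊔ ℓ)
  RankLe {m} {n} A r = Σ (Matrix m r) λ B → Σ (Matrix r n) λ C →
    ∀ a b → A a b ≈ sum (λ t → B a t * C t b)

  RankEq : ∀ {m n} → Matrix m n → ℕ → Set (c ⊔ ℓ)
  RankEq A zero    = RankLe A zero
  RankEq A (suc r) = RankLe A (suc r) × ¬ RankLe A r

  δ : ∀ {n} → Fin n → Fin n → Carrier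
  δ a b with a ≟ b
  ... | yes _ = 1#
  ... | no  _ = 0#

  -- M_n^k = Σ_{i ∈ [n]^k} ⊗_ℓ e_{i_ℓ, i_{ℓ+1}}  (i_{k+1} = i_1), order k = suc p,
  -- each factor K^{n²} with e_{a,b} the basis vector of index combine a b
  MM : (n p : ℕ) → Tensor {suc p} (λ _ → n Nat.* n)
  MM n p j = sumI {suc p} (λ _ → n)
    (λ i → prod (λ ℓ → δ (j ℓ) (combine (i ℓ) (i (next ℓ)))))

  _⊗v_ : ∀ {p} {m : Fin (suc p) → ℕ} →
         Tensor (λ ℓ → m (Data.Fin.inject₁ ℓ)) → (Fin (m (Data.Fin.fromℕ p)) → Carrier) → Tensor m
  _⊗v_ {p} S w j = S (λ ℓ → j (Data.Fin.inject₁ ℓ)) * w (j (Data.Fin.fromℕ p))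

-- Write A_k = β γᵀ.  Expanding (A₁ ⊗ ⋯ ⊗ A_k) M_n^k at an index j gives
-- Σ_i ∏_ℓ A_ℓ(j_ℓ, e_{i_ℓ i_{ℓ+1}}), and the summation variable i_k occurs
-- only in the last two factors A_{k-1}(j_{k-1}, e_{i_{k-1} i_k}) β(j_k) γ(e_{i_k i_1}).
-- Summing it out leaves β(j_k) B(j_{k-1}, e_{i_{k-1} i_1}) with
-- B(a, e_{xy}) = Σ_c A_{k-1}(a, e_{xc}) γ(e_{cy}), which is the expansion of
-- ((A₁ ⊗ ⋯ ⊗ A_{k-2} ⊗ B) M_n^{k-1})_{j₁…j_{k-1}} times β(j_k).
module Submission where

open import Defs
open import Level using (Level)
open import Data.Nat using (ℕ; suc)
import Data.Nat as Nat
open import Data.Fin using (Fin; inject₁; fromℕ)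
open import Data.Product using (Σ; _×_)
open FieldDefs using (Matrix; RankEq; Tensor; MM; _≥T_; _≈T_; applyT; _⊗v_)

open import Data.Fin using (zero; suc; combine; remQuot; _≟_)
open import Data.Fin.Properties using (remQuot-combine)
open import Data.Product using (_,_; proj₁; proj₂; ∃₂)
open import Relation.Nullary using (yes; no)
open import Data.Empty using (⊥-elim)
open import Function using (_∘_)
open import Relation.Binary.PropositionalEquality as ≡ using (_≡_)

next-inject₁ : ∀ {k} (x : Fin k) → next (inject₁ x) ≡ suc x
next-inject₁ {suc k} zero    = ≡.refl
next-inject₁ {suc k} (suc x) with next {k} (inject₁ x) | next-inject₁ x
... | _ | ≡.refl = ≡.refl

next-fromℕ : ∀ k → next (fromℕ k) ≡ zero
next-fromℕ Nat.zero = ≡.refl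
next-fromℕ (suc k) with next {k} (fromℕ k) | next-fromℕ k
... | _ | ≡.refl = ≡.refl

snoc : ∀ {a k} {P : Fin (suc k) → Set a} →
       ((x : Fin k) → P (inject₁ x)) → P (fromℕ k) → (x : Fin (suc k)) → P x
snoc {k = Nat.zero} f z zero    = z
snoc {k = suc k}    f z zero    = f zero
snoc {k = suc k}    f z (suc x) = snoc (f ∘ suc) z x

snoc-inject₁ : ∀ {a k} {P : Fin (suc k) → Set a} (f : (x : Fin k) → P (inject₁ x)) z x →
               snoc {P = P} f z (inject₁ x) ≡ f x
snoc-inject₁ {k = suc k} f z zero    = ≡.refl
snoc-inject₁ {k = suc k} f z (suc x) = snoc-inject₁ (f ∘ suc) z x

snoc-fromℕ : ∀ {a k} {P : Fin (suc k) → Set a} (f : (x : Fin k) → P (inject₁ x)) z →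
             snoc {P = P} f z (fromℕ k) ≡ z
snoc-fromℕ {k = Nat.zero} f z = ≡.refl
snoc-fromℕ {k = suc k}    f z = snoc-fromℕ (f ∘ suc) z

cycleEdge : ∀ {n k} → (Fin (suc k) → Fin n) → Fin (suc k) → Fin (n Nat.* n)
cycleEdge i x = combine (i x) (i (next x))

module _ {n k} (i : Fin (suc k) → Fin n) where

  cycleEdge-inject₁ : ∀ x → cycleEdge i (inject₁ x) ≡ combine (i (inject₁ x)) (i (suc x))
  cycleEdge-inject₁ x = ≡.cong (combine (i (inject₁ x)) ∘ i) (next-inject₁ x)

  cycleEdge-fromℕ : cycleEdge i (fromℕ k) ≡ combine (i (fromℕ k)) (i zero)
  cycleEdge-fromℕ = ≡.cong (combine (i (fromℕ k)) ∘ i) (next-fromℕ k)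

module _ {n k} (i : Fin (suc k) → Fin n) (c : Fin n) where

  cycleEdge-snoc-inject₁² : ∀ x → cycleEdge (snoc i c) (inject₁ (inject₁ x)) ≡ cycleEdge i (inject₁ x)
  cycleEdge-snoc-inject₁² x = begin
    cycleEdge (snoc i c) (inject₁ (inject₁ x))
      ≡⟨ cycleEdge-inject₁ (snoc i c) (inject₁ x) ⟩
    combine (snoc i c (inject₁ (inject₁ x))) (snoc i c (inject₁ (suc x)))
      ≡⟨ ≡.cong₂ combine (snoc-inject₁ i c (inject₁ x)) (snoc-inject₁ i c (suc x)) ⟩
    combine (i (inject₁ x)) (i (suc x))
      ≡⟨ cycleEdge-inject₁ i x ⟨
    cycleEdge i (inject₁ x) ∎
    where open ≡.≡-Reasoning

  cycleEdge-snoc-inject₁-fromℕ : cycleEdge (snoc i c) (inject₁ (fromℕ k)) ≡ combine (i (fromℕ k)) c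
  cycleEdge-snoc-inject₁-fromℕ =
    ≡.trans (cycleEdge-inject₁ (snoc i c) (fromℕ k))
            (≡.cong₂ combine (snoc-inject₁ i c (fromℕ k)) (snoc-fromℕ i c))

  cycleEdge-snoc-fromℕ : cycleEdge (snoc i c) (fromℕ (suc k)) ≡ combine c (i zero)
  cycleEdge-snoc-fromℕ =
    ≡.trans (cycleEdge-fromℕ (snoc i c)) (≡.cong (λ a → combine a (i zero)) (snoc-fromℕ i c))

module _ {c ℓ} (K : Field c ℓ) where
  open Field K hiding (zero)
  open FieldDefs K hiding (Matrix; RankEq; Tensor; MM; _≥T_; _≈T_; applyT; _⊗v_)
  open import Algebra.Properties.Semiring.Sum semiring
    using (sum; ∑-comm; *-distribˡ-sum; *-distribʳ-sum; sum-cong-≋; sum-replicate-zero)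
  open import Algebra.Properties.CommutativeSemigroup *-commutativeSemigroup
    using (interchange; xy∙z≈xz∙y)
  open import Relation.Binary.Reasoning.Setoid setoid

  sum-zero : ∀ {n} {f : Fin n → Carrier} → (∀ i → f i ≈ 0#) → sum f ≈ 0#
  sum-zero {n} f≈0 = trans (sum-cong-≋ f≈0) (sum-replicate-zero n)

  δ-refl : ∀ {n} (a : Fin n) → δ a a ≈ 1#
  δ-refl a with a ≟ a
  ... | yes _ = refl
  ... | no a≢a = ⊥-elim (a≢a ≡.refl)

  δ-suc : ∀ {n} (a b : Fin n) → δ (suc a) (suc b) ≈ δ a b
  δ-suc a b with a ≟ b
  ... | yes _ = refl
  ... | no _  = refl

  sum-*δ : ∀ {n} (f : Fin n → Carrier) b → sum (λ a → f a * δ a b) ≈ f b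
  sum-*δ {suc n} f zero = begin
    f zero * δ {suc n} zero zero + sum (λ a → f (suc a) * δ (suc a) zero)
      ≈⟨ +-cong (trans (*-congˡ (δ-refl {suc n} zero)) (*-identityʳ _))
                (sum-zero {n} (λ a → zeroʳ _)) ⟩
    f zero + 0#  ≈⟨ +-identityʳ _ ⟩
    f zero       ∎
  sum-*δ {suc n} f (suc b) = begin
    f zero * δ zero (suc b) + sum (λ a → f (suc a) * δ (suc a) (suc b))
      ≈⟨ +-cong (zeroʳ _)
                (sum-cong-≋ (λ a → *-congˡ (δ-suc a b))) ⟩
    0# + sum (λ a → f (suc a) * δ a b)  ≈⟨ +-identityˡ _ ⟩
    sum (λ a → f (suc a) * δ a b)        ≈⟨ sum-*δ (f ∘ suc) b ⟩
    f (suc b)                            ∎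

  prod-cong : ∀ {k} {f g : Fin k → Carrier} → (∀ i → f i ≈ g i) → prod f ≈ prod g
  prod-cong {Nat.zero} f≈g = refl
  prod-cong {suc k}    f≈g = *-cong (f≈g zero) (prod-cong (f≈g ∘ suc))

  prod-* : ∀ {k} (f g : Fin k → Carrier) → prod f * prod g ≈ prod (λ i → f i * g i)
  prod-* {Nat.zero} f g = *-identityˡ 1#
  prod-* {suc k}    f g = trans (interchange _ _ _ _) (*-congˡ (prod-* (f ∘ suc) (g ∘ suc)))

  prod-init-last : ∀ {k} (f : Fin (suc k) → Carrier) → prod f ≈ prod (f ∘ inject₁) * f (fromℕ k)
  prod-init-last {Nat.zero} f = trans (*-identityʳ _) (sym (*-identityˡ _))
  prod-init-last {suc k}    f = trans (*-congˡ (prod-init-last (f ∘ suc))) (sym (*-assoc _ _ _))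

  tail : ∀ {k} → (Fin (suc k) → ℕ) → Fin k → ℕ
  tail d = d ∘ suc

  sumI-cong : ∀ {k} (d : Fin k → ℕ) {f g : Index d → Carrier} → (∀ i → f i ≈ g i) → sumI d f ≈ sumI d g
  sumI-cong {Nat.zero} d f≈g = f≈g _
  sumI-cong {suc k}    d f≈g = sum-cong-≋ {d zero} (λ a → sumI-cong (tail d) (λ i → f≈g (consI {d = d} a i)))

  *-distribˡ-sumI : ∀ {k} (d : Fin k → ℕ) x (f : Index d → Carrier) → x * sumI d f ≈ sumI d (λ i → x * f i)
  *-distribˡ-sumI {Nat.zero} d x f = refl
  *-distribˡ-sumI {suc k}    d x f =
    trans (*-distribˡ-sum {d zero} x _)
          (sum-cong-≋ {d zero} (λ a → *-distribˡ-sumI (tail d) x (f ∘ consI {d = d} a)))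

  *-distribʳ-sumI : ∀ {k} (d : Fin k → ℕ) x (f : Index d → Carrier) → sumI d f * x ≈ sumI d (λ i → f i * x)
  *-distribʳ-sumI d x f =
    trans (*-comm _ _) (trans (*-distribˡ-sumI d x f) (sumI-cong d (λ i → *-comm _ _)))

  ∑-sumI-comm : ∀ {m k} (d : Fin k → ℕ) (f : Fin m → Index d → Carrier) →
                sum (λ a → sumI d (f a)) ≈ sumI d (λ i → sum (λ a → f a i))
  ∑-sumI-comm {k = Nat.zero} d f = refl
  ∑-sumI-comm {m} {suc k}    d f =
    trans (∑-comm {m} {d zero} (λ a b → sumI (tail d) (f a ∘ consI {d = d} b)))
          (sum-cong-≋ {d zero} (λ b → ∑-sumI-comm (tail d) (λ a → f a ∘ consI {d = d} b)))

  sumI-comm : ∀ {k k′} (d : Fin k → ℕ) (e : Fin k′ → ℕ) (f : Index d → Index e → Carrier) →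
              sumI d (λ x → sumI e (f x)) ≈ sumI e (λ i → sumI d (λ x → f x i))
  sumI-comm {Nat.zero} d e f = refl
  sumI-comm {suc k}    d e f =
    trans (sum-cong-≋ {d zero} (λ a → sumI-comm (tail d) e (f ∘ consI {d = d} a)))
          (∑-sumI-comm e (λ a i → sumI (tail d) (λ x → f (consI {d = d} a x) i)))

  sumI-prod : ∀ {k} (d : Fin k → ℕ) (f : (x : Fin k) → Fin (d x) → Carrier) →
              sumI d (λ i → prod (λ x → f x (i x))) ≈ prod (λ x → sum (f x))
  sumI-prod {Nat.zero} d f = refl
  sumI-prod {suc k}    d f = begin
    sum (λ a → sumI (tail d) (λ i → f zero a * prod (λ x → f (suc x) (i x))))
      ≈⟨ sum-cong-≋ {d zero} (λ a → *-distribˡ-sumI (tail d) (f zero a) _) ⟨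
    sum (λ a → f zero a * sumI (tail d) (λ i → prod (λ x → f (suc x) (i x))))
      ≈⟨ sum-cong-≋ {d zero} (λ a → *-congˡ (sumI-prod (tail d) (f ∘ suc))) ⟩
    sum (λ a → f zero a * prod (λ x → sum (f (suc x))))
      ≈⟨ *-distribʳ-sum _ (f zero) ⟨
    sum (f zero) * prod (λ x → sum (f (suc x))) ∎

  sumI-init-last : ∀ {k} (d : Fin (suc k) → ℕ) (f : Index d → Carrier) →
                   (∀ {i i′} → (∀ x → i x ≡ i′ x) → f i ≈ f i′) →
                   sumI d f ≈ sumI (d ∘ inject₁) (λ i → sum (λ c → f (snoc i c)))
  sumI-init-last {Nat.zero} d f f-cong =
    sum-cong-≋ {d zero} (λ a → f-cong λ { zero → ≡.refl })
  sumI-init-last {suc k}    d f f-cong =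
    sum-cong-≋ {d zero} (λ a → trans
      (sumI-init-last (tail d) (f ∘ consI {d = d} a)
        (λ i≡i′ → f-cong λ { zero → ≡.refl ; (suc x) → i≡i′ x }))
      (sumI-cong (tail d ∘ inject₁) (λ i → sum-cong-≋ {d (fromℕ (suc k))} (λ c →
        f-cong λ { zero → ≡.refl ; (suc x) → ≡.refl }))))

  applyT-MM : ∀ n p {e : Fin (suc p) → ℕ} (B : (x : Fin (suc p)) → Matrix K (e x) (n Nat.* n)) j →
              applyT K B (MM K n p) j ≈ sumI (λ _ → n) (λ i → prod (λ x → B x (j x) (cycleEdge i x)))
  applyT-MM n p B j = begin
    sumI D (λ y → Bj y * sumI N (Δ y))
      ≈⟨ sumI-cong D (λ y → *-distribˡ-sumI N (Bj y) (Δ y)) ⟩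
    sumI D (λ y → sumI N (λ i → Bj y * Δ y i))
      ≈⟨ sumI-comm D N (λ y i → Bj y * Δ y i) ⟩
    sumI N (λ i → sumI D (λ y → Bj y * Δ y i))
      ≈⟨ sumI-cong N (λ i → sumI-cong D (λ y → prod-* (λ x → B x (j x) (y x)) (λ x → δ (y x) (cycleEdge i x)))) ⟩
    sumI N (λ i → sumI D (λ y → prod (λ x → B x (j x) (y x) * δ (y x) (cycleEdge i x))))
      ≈⟨ sumI-cong N (λ i → sumI-prod D (λ x a → B x (j x) a * δ a (cycleEdge i x))) ⟩
    sumI N (λ i → prod (λ x → sum (λ a → B x (j x) a * δ a (cycleEdge i x))))
      ≈⟨ sumI-cong N (λ i → prod-cong (λ x → sum-*δ (B x (j x)) (cycleEdge i x))) ⟩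
    sumI N (λ i → prod (λ x → B x (j x) (cycleEdge i x))) ∎
    where
    D N : Fin (suc p) → ℕ
    D _ = n Nat.* n
    N _ = n
    Bj : Index D → Carrier
    Bj y = prod (λ x → B x (j x) (y x))
    Δ : Index D → Index N → Carrier
    Δ y i = prod (λ x → δ (y x) (cycleEdge i x))

  contract : ∀ {m n} → Matrix K m (n Nat.* n) → (Fin (n Nat.* n) → Carrier) → Matrix K m (n Nat.* n)
  contract {n = n} A γ a y =
    sum {n} (λ c → A a (combine (proj₁ (remQuot {n} n y)) c) * γ (combine c (proj₂ (remQuot {n} n y))))

  contract-combine : ∀ {m n} (A : Matrix K m (n Nat.* n)) (γ : Fin (n Nat.* n) → Carrier) a (x y : Fin n) →
                     contract {n = n} A γ a (combine x y) ≈ sum {n} (λ c → A a (combine x c) * γ (combine c y))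
  contract-combine {n = n} A γ a x y =
    reflexive (≡.cong (λ (x , y) → sum {n} (λ c → A a (combine x c) * γ (combine c y)))
                      (remQuot-combine {n} {n} x y))

  rankLe1⇒outer : ∀ {m n} {A : Matrix K m n} → RankLe A 1 →
                  ∃₂ λ (β : Fin m → Carrier) (γ : Fin n → Carrier) → ∀ a b → A a b ≈ β a * γ b
  rankLe1⇒outer (B , C , A≈BC) = (λ a → B a zero) , C zero , λ a b → trans (A≈BC a b) (+-identityʳ _)

  module _ (n p : ℕ) (m : Fin (suc (suc p)) → ℕ) (A : (x : Fin (suc (suc p))) → Matrix K (m x) (n Nat.* n))
           (β : Fin (m (fromℕ (suc p))) → Carrier) (γ : Fin (n Nat.* n) → Carrier)
           (A-last≈βγ : ∀ a b → A (fromℕ (suc p)) a b ≈ β a * γ b) where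

    contracted : (x : Fin (suc p)) → Matrix K (m (inject₁ x)) (n Nat.* n)
    contracted = snoc {P = λ x → Matrix K (m (inject₁ x)) (n Nat.* n)}
                      (A ∘ inject₁ ∘ inject₁) (contract {n = n} (A (inject₁ (fromℕ p))) γ)

    contracted-inject₁ : ∀ x → contracted (inject₁ x) ≡ A (inject₁ (inject₁ x))
    contracted-inject₁ = snoc-inject₁ (A ∘ inject₁ ∘ inject₁) _

    contracted-fromℕ : contracted (fromℕ p) ≡ contract {n = n} (A (inject₁ (fromℕ p))) γ
    contracted-fromℕ = snoc-fromℕ {P = λ x → Matrix K (m (inject₁ x)) (n Nat.* n)} (A ∘ inject₁ ∘ inject₁) _

    module _ (j : Index m) (i : Fin (suc p) → Fin n) where

      innerFactors : Carrier
      innerFactors = prod (λ x → A (inject₁ (inject₁ x)) (j (inject₁ (inject₁ x))) (cycleEdge i (inject₁ x)))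

      leftFactor rightFactor : Fin n → Carrier
      leftFactor c  = A (inject₁ (fromℕ p)) (j (inject₁ (fromℕ p))) (combine (i (fromℕ p)) c)
      rightFactor c = γ (combine c (i zero))

      cycle-snoc : ∀ c → prod (λ x → A x (j x) (cycleEdge (snoc i c) x))
                         ≈ (innerFactors * leftFactor c) * (β (j (fromℕ (suc p))) * rightFactor c)
      cycle-snoc c = begin
        prod H                                             ≈⟨ prod-init-last H ⟩
        prod (H ∘ inject₁) * H (fromℕ (suc p))             ≈⟨ *-congʳ (prod-init-last (H ∘ inject₁)) ⟩
        (prod (H ∘ inject₁ ∘ inject₁) * H (inject₁ (fromℕ p))) * H (fromℕ (suc p))
          ≈⟨ *-cong (*-cong (prod-cong (λ x → reflexive (≡.cong (A _ _) (cycleEdge-snoc-inject₁² i c x))))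
                            (reflexive (≡.cong (A _ _) (cycleEdge-snoc-inject₁-fromℕ i c))))
                    (trans (reflexive (≡.cong (A _ _) (cycleEdge-snoc-fromℕ i c))) (A-last≈βγ _ _)) ⟩
        (innerFactors * leftFactor c) * (β (j (fromℕ (suc p))) * rightFactor c) ∎
        where
        H : Fin (suc (suc p)) → Carrier
        H x = A x (j x) (cycleEdge (snoc i c) x)

      cycle-contracted : prod (λ x → contracted x (j (inject₁ x)) (cycleEdge i x))
                         ≈ innerFactors * sum (λ c → leftFactor c * rightFactor c)
      cycle-contracted = begin
        prod H                                    ≈⟨ prod-init-last H ⟩
        prod (H ∘ inject₁) * H (fromℕ p)
          ≈⟨ *-cong (prod-cong (λ x → reflexive (≡.cong (λ M → M _ _) (contracted-inject₁ x))))
                    (reflexive (≡.cong₂ (λ M e → M (j (inject₁ (fromℕ p))) e)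
                                        contracted-fromℕ (cycleEdge-fromℕ i))) ⟩
        innerFactors * contract {n = n} (A (inject₁ (fromℕ p))) γ (j (inject₁ (fromℕ p))) (combine (i (fromℕ p)) (i zero))
          ≈⟨ *-congˡ (contract-combine (A (inject₁ (fromℕ p))) γ (j (inject₁ (fromℕ p))) (i (fromℕ p)) (i zero)) ⟩
        innerFactors * sum (λ c → leftFactor c * rightFactor c) ∎
        where
        H : Fin (suc p) → Carrier
        H x = contracted x (j (inject₁ x)) (cycleEdge i x)

      sum-cycle-snoc : sum (λ c → prod (λ x → A x (j x) (cycleEdge (snoc i c) x)))
                       ≈ prod (λ x → contracted x (j (inject₁ x)) (cycleEdge i x)) * β (j (fromℕ (suc p)))
      sum-cycle-snoc = begin
        sum (λ c → prod (λ x → A x (j x) (cycleEdge (snoc i c) x)))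
          ≈⟨ sum-cong-≋ {n} (λ c → trans (cycle-snoc c) (interchange _ _ _ _)) ⟩
        sum (λ c → (innerFactors * b) * (leftFactor c * rightFactor c))  ≈⟨ *-distribˡ-sum {n} (innerFactors * b) _ ⟨
        (innerFactors * b) * sum (λ c → leftFactor c * rightFactor c)    ≈⟨ xy∙z≈xz∙y innerFactors b _ ⟩
        (innerFactors * sum (λ c → leftFactor c * rightFactor c)) * b    ≈⟨ *-congʳ cycle-contracted ⟨
        prod (λ x → contracted x (j (inject₁ x)) (cycleEdge i x)) * b ∎
        where
        b : Carrier
        b = β (j (fromℕ (suc p)))

    applyT-MM-contract : _≈T_ K (applyT K A (MM K n (suc p))) (_⊗v_ K (applyT K contracted (MM K n p)) β)
    applyT-MM-contract j = begin
      applyT K A (MM K n (suc p)) j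
        ≈⟨ applyT-MM n (suc p) A j ⟩
      sumI N (λ i → prod (λ x → A x (j x) (cycleEdge i x)))
        ≈⟨ sumI-init-last N _ (λ i≡i′ → prod-cong (λ x →
             reflexive (≡.cong₂ (λ a b → A x (j x) (combine a b)) (i≡i′ x) (i≡i′ (next x))))) ⟩
      sumI N (λ i → sum (λ c → prod (λ x → A x (j x) (cycleEdge (snoc i c) x))))
        ≈⟨ sumI-cong N (sum-cycle-snoc j) ⟩
      sumI N (λ i → prod (λ x → contracted x (j (inject₁ x)) (cycleEdge i x)) * β (j (fromℕ (suc p))))
        ≈⟨ *-distribʳ-sumI N (β (j (fromℕ (suc p)))) (λ i → prod (λ x → contracted x (j (inject₁ x)) (cycleEdge i x))) ⟨
      sumI N (λ i → prod (λ x → contracted x (j (inject₁ x)) (cycleEdge i x))) * β (j (fromℕ (suc p)))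
        ≈⟨ *-congʳ (applyT-MM n p contracted (j ∘ inject₁)) ⟨
      applyT K contracted (MM K n p) (j ∘ inject₁) * β (j (fromℕ (suc p))) ∎
      where
      N : ∀ {k} → Fin k → ℕ
      N _ = n

lemma4p1 : ∀ {c ℓ} (K : Field c ℓ) (n p : ℕ) (m : Fin (suc (suc p)) → ℕ)
    (A : (i : Fin (suc (suc p))) → Matrix K (m i) (n Nat.* n)) →
    RankEq K (A (fromℕ (suc p))) 1 →
    Σ (Tensor K (λ i → m (inject₁ i))) λ S →
    Σ (Fin (m (fromℕ (suc p))) → Field.Carrier K) λ w →
      _≥T_ K (MM K n p) S × _≈T_ K (applyT K A (MM K n (suc p))) (_⊗v_ K S w)
lemma4p1 K n p m A (rank≤1 , _) =
  let β , γ , A-last≈βγ = rankLe1⇒outer K rank≤1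
      B = contracted K n p m A β γ A-last≈βγ
  in applyT K B (MM K n p) , β , (B , λ _ → Field.refl K) , applyT-MM-contract K n p m A β γ A-last≈βγ
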